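{- Each of the four interpolating inference rules Hyp-A, Hyp-B, Comb and Strengthen defined below preserves validity of annotated sequents: whenever all premises of an instance of one of these rules are valid annotated sequents (a rule without premises has none), the conclusion of that instance is a valid annotated sequent. The rules (for fixed conjunctions $A$, $B$ of $\mathcal{LA}(\mathbb{Z})$ equalities and inequalities) are: (1) Hyp-A: derive $(A,B)\vdash (t\le 0)\,[\{\langle t\le 0,\top\rangle\}]$, provided $(t\le 0)$ or $(t=0)$ is a conjunct of $A$. (2) Hyp-B: derive $(A,B)\vdash (t\le 0)\,[\{\langle 0\le 0,\top\rangle\}]$, provided $(t\le 0)$ or $(t=0)$ is a conjunct of $B$. (3) Comb: from $(A,B)\vdash (t_1\le 0)[I_1]$ and $(A,B)\vdash (t_2\le 0)[I_2]$ derive $(A,B)\vdash (c_1t_1+c_2t_2\le 0)[I]$, where $c_1,c_2>0$ and $I=\{\langle c_1t_1'+c_2t_2'\le 0,\ E_1\wedge E_2\rangle \mid \langle t_1'\le 0,E_1\rangle\in I_1,\ \langle t_2'\le 0,E_2\rangle\in I_2\}$. (4) Strengthen: from $(A,B)\vdash (\sum_i c_ix_i+c\le 0)\,[\{\langle t'\le 0,\top\rangle\}]$ derive $(A,B)\vdash (\sum_i c_ix_i+c+k\le 0)\,[I]$, where $d>0$ is an integer dividing all the $c_i$, $k= d\lceil c/d\rceil - c$, and $I=\{\langle t'+j\le 0,\ \exists(x\notin B).(t'+j=0)\rangle \mid 0\le j<k\}\cup\{\langle t'+k\le 0,\top\rangle\}$; here $\exists(x\notin B).(t'+j=0)$ denotes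 the result of existentially eliminating from the equation $t'+j=0$ all and only the variables not occurring in $B$, i.e. $\exists x_1,\dots,x_n.(\sum_i e_ix_i+\sum_j f_jy_j+e=0)$ is replaced by the modular equation $\sum_j f_jy_j+e=_{\gcd(e_i)}0$.
   Context: $\mathcal{LA}(\mathbb{Z})$ is linear arithmetic over the integers: all variables range over $\mathbb{Z}$, terms are linear combinations of variables with integer coefficients plus an integer constant, and $\models$ denotes entailment over integer assignments. A modular equation $t=_g 0$ (for an integer $g\ge 0$) means $g$ divides $t$; $t=_0 0$ means $t=0$. For a term or formula $\phi$ and a formula $\psi$, $\phi\preceq\psi$ means every variable occurring in $\phi$ occurs in $\psi$. An annotated sequent has the form $(A,B)\vdash (t\le 0)\,[I]$ where $A,B$ are conjunctions of $\mathcal{LA}(\mathbb{Z})$ equalities and inequalities, $t$ is a linear term, and $I$ (the annotation) is a set of pairs $\langle t_i\le 0, E_i\rangle$ with $t_i$ a linear term and $E_i$ a (possibly empty, i.e. $\top$) conjunction of equalities and modular equalities. It is valid when: (1) $A\models \bigvee_{\langle t_i\le 0,E_i\rangle\in I}((t_i\le 0)\wedge E_i)$; (2) for every $\langle t_i\le 0,E_i\rangle\in I$, $B\wedge E_i\models (t-t_i\le 0)$; (3) for every $\langle t_i\le 0,E_i\rangle\in I$, $t_i\preceq A$, $(t-t_i)\preceq B$, $E_i\preceq A$ and $E_i\preceq B$. -}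

module Defs where

open import Data.Nat as ℕ using (ℕ; zero; suc)
open import Data.Nat.GCD using (gcd)
open import Data.Integer as ℤ using (ℤ; +_; -_; _/ℕ_; ∣_∣)
open import Data.Integer.Divisibility as ℤD using ()
open import Data.Bool using (Bool; true; false; if_then_else_; not)
open import Data.Bool.ListAction using (any)
open import Data.List using (List; []; _∷_; concatMap; map; upTo; _++_; [_])
open import Data.List.Relation.Unary.All using (All)
open import Data.List.Relation.Unary.Any using (Any)
open import Data.List.Membership.Propositional using (_∈_)
open import Data.Product using (_×_; _,_; proj₁; proj₂)
open import Data.Sum using (_⊎_)
open import Relation.Binary.PropositionalEquality using (_≡_)
open import Relation.Nullary using (¬_; does)

Var : Set
Var = ℕ

Assignment : Set
Assignment = Var → ℤ

-- A linear term  Σ_i coeffs[i] · x_i + const .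
-- (Variables beyond the length of the list have coefficient 0.)
record Term : Set where
  constructor term
  field
    coeffs : List ℤ
    const  : ℤ
open Term public

coeffL : List ℤ → Var → ℤ
coeffL []       _       = ℤ.0ℤ
coeffL (c ∷ cs) zero    = c
coeffL (c ∷ cs) (suc x) = coeffL cs x

coeff : Term → Var → ℤ
coeff t x = coeffL (coeffs t) x

evalL : List ℤ → Assignment → ℤ
evalL []       σ = ℤ.0ℤ
evalL (c ∷ cs) σ = c ℤ.* σ zero ℤ.+ evalL cs (λ x → σ (suc x))

⟦_⟧ : Term → Assignment → ℤ
⟦ t ⟧ σ = evalL (coeffs t) σ ℤ.+ const t

addL : List ℤ → List ℤ → List ℤ
addL []       ds       = ds
addL (c ∷ cs) []       = c ∷ cs
addL (c ∷ cs) (d ∷ ds) = (c ℤ.+ d) ∷ addL cs ds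

_⊕_ : Term → Term → Term
s ⊕ t = term (addL (coeffs s) (coeffs t)) (const s ℤ.+ const t)

_⊛_ : ℤ → Term → Term
a ⊛ t = term (map (a ℤ.*_) (coeffs t)) (a ℤ.* const t)

⊖ : Term → Term
⊖ t = (ℤ.-1ℤ) ⊛ t

_⊝_ : Term → Term → Term
s ⊝ t = s ⊕ ⊖ t

_+ᶜ_ : Term → ℤ → Term
t +ᶜ k = term (coeffs t) (const t ℤ.+ k)

𝟘 : Term
𝟘 = term [] ℤ.0ℤ

Occurs : Var → Term → Set
Occurs x t = ¬ (coeff t x ≡ ℤ.0ℤ)

occurs? : Var → Term → Bool
occurs? x t = not (does (coeff t x ℤ.≟ ℤ.0ℤ))

data Constraint : Set where
  le : Term → Constraint
  eq : Term → Constraint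

termOf : Constraint → Term
termOf (le t) = t
termOf (eq t) = t

holdsC : Constraint → Assignment → Set
holdsC (le t) σ = ⟦ t ⟧ σ ℤ.≤ ℤ.0ℤ
holdsC (eq t) σ = ⟦ t ⟧ σ ≡ ℤ.0ℤ

Conj : Set
Conj = List Constraint

holds : Conj → Assignment → Set
holds A σ = All (λ c → holdsC c σ) A

OccursIn : Var → Conj → Set
OccursIn x A = Any (λ c → Occurs x (termOf c)) A

occursIn? : Var → Conj → Bool
occursIn? x A = any (λ c → occurs? x (termOf c)) A

data EqAtom : Set where
  eqz  : Term → EqAtom
  modz : ℕ → Term → EqAtom    -- t =_g 0   (g ∣ t; for g = 0 this means t = 0)

termOfE : EqAtom → Term
termOfE (eqz t)    = t
termOfE (modz _ t) = t

holdsE : EqAtom → Assignment → Set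
holdsE (eqz t)    σ = ⟦ t ⟧ σ ≡ ℤ.0ℤ
holdsE (modz g t) σ = (+ g) ℤD.∣ ⟦ t ⟧ σ

-- conjunction of (modular) equalities; [] is ⊤
EConj : Set
EConj = List EqAtom

holdsEs : EConj → Assignment → Set
holdsEs E σ = All (λ e → holdsE e σ) E

OccursInE : Var → EConj → Set
OccursInE x E = Any (λ e → Occurs x (termOfE e)) E

_≼_ : Term → Conj → Set
t ≼ A = ∀ x → Occurs x t → OccursIn x A

_≼ᴱ_ : EConj → Conj → Set
E ≼ᴱ A = ∀ x → OccursInE x E → OccursIn x A

-- an annotation element ⟨ tᵢ ≤ 0 , Eᵢ ⟩
AnnElem : Set
AnnElem = Term × EConj

-- the annotation I (a finite set, represented as a list)
Annotation : Set
Annotation = List AnnElem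

record Valid (A B : Conj) (t : Term) (I : Annotation) : Set where
  field
    cond1 : ∀ σ → holds A σ →
              Any (λ p → (⟦ proj₁ p ⟧ σ ℤ.≤ ℤ.0ℤ) × holdsEs (proj₂ p) σ) I
    cond2 : ∀ p → p ∈ I → ∀ σ → holds B σ → holdsEs (proj₂ p) σ →
              ⟦ t ⊝ proj₁ p ⟧ σ ℤ.≤ ℤ.0ℤ
    cond3 : ∀ p → p ∈ I →
              (proj₁ p ≼ A) × ((t ⊝ proj₁ p) ≼ B) ×
              (proj₂ p ≼ᴱ A) × (proj₂ p ≼ᴱ B)

combAnn : ℤ → ℤ → Annotation → Annotation → Annotation
combAnn c₁ c₂ I₁ I₂ =
  concatMap (λ p₁ → map (λ p₂ → ((c₁ ⊛ proj₁ p₁) ⊕ (c₂ ⊛ proj₁ p₂)) ,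
                                 (proj₂ p₁ ++ proj₂ p₂)) I₂) I₁

-- ceiling division ⌈ c / d ⌉ for d > 0 (value for d = 0 irrelevant)
ceilDiv : ℤ → ℕ → ℤ
ceilDiv c zero    = ℤ.0ℤ
ceilDiv c (suc n) = - ((- c) /ℕ suc n)

-- keep only coefficients of variables occurring in B  (the yⱼ part)
restrictB : Conj → Var → List ℤ → List ℤ
restrictB B i []       = []
restrictB B i (c ∷ cs) =
  (if occursIn? i B then c else ℤ.0ℤ) ∷ restrictB B (suc i) cs

-- gcd of the coefficients of the variables not occurring in B (the eᵢ);
-- gcd of the empty family is 0
gcdNotB : Conj → Var → List ℤ → ℕ
gcdNotB B i []       = 0
gcdNotB B i (c ∷ cs) =
  if occursIn? i B then gcdNotB B (suc i) cs else gcd ∣ c ∣ (gcdNotB B (suc i) cs)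

-- ∃(x ∉ B). (t = 0)   ↦   Σ fⱼ yⱼ + e  =_{gcd(eᵢ)} 0
elimNotB : Conj → Term → EConj
elimNotB B t = [ modz (gcdNotB B 0 (coeffs t)) (term (restrictB B 0 (coeffs t)) (const t)) ]

strengthenAnn : Conj → Term → ℤ → Annotation
strengthenAnn B t' k =
  map (λ j → (t' +ᶜ (+ j)) , elimNotB B (t' +ᶜ (+ j))) (upTo ∣ k ∣)
  ++ [ (t' +ᶜ k) , [] ]

HypA-sound : Set
HypA-sound = ∀ (A B : Conj) (t : Term) →
  (le t ∈ A ⊎ eq t ∈ A) → Valid A B t [ t , [] ]

HypB-sound : Set
HypB-sound = ∀ (A B : Conj) (t : Term) →
  (le t ∈ B ⊎ eq t ∈ B) → Valid A B t [ 𝟘 , [] ]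

Comb-sound : Set
Comb-sound = ∀ (A B : Conj) (t₁ t₂ : Term) (I₁ I₂ : Annotation) (c₁ c₂ : ℤ) →
  ℤ.0ℤ ℤ.< c₁ → ℤ.0ℤ ℤ.< c₂ →
  Valid A B t₁ I₁ → Valid A B t₂ I₂ →
  Valid A B ((c₁ ⊛ t₁) ⊕ (c₂ ⊛ t₂)) (combAnn c₁ c₂ I₁ I₂)

-- the premise term is  Σᵢ cᵢxᵢ + c  with cs = (cᵢ)ᵢ
Strengthen-sound : Set
Strengthen-sound = ∀ (A B : Conj) (cs : List ℤ) (c : ℤ) (t' : Term) (d : ℕ) →
  0 ℕ.< d → All (λ cᵢ → (+ d) ℤD.∣ cᵢ) cs →
  Valid A B (term cs c) [ t' , [] ] →
  let k = (+ d) ℤ.* ceilDiv c d ℤ.- c in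
  Valid A B (term cs c +ᶜ k) (strengthenAnn B t' k)

-- Hyp-A, Hyp-B and Comb only use that evaluation and coefficients are linear
-- in the term: a positive combination of annotation elements of the two
-- premises bounds the combined term, and the variable conditions combine
-- coefficientwise.
-- Strengthen is where integrality enters. The premise gives t' ≤ 0 under A and
-- Σ cᵢxᵢ + c - t' ≤ 0 under B with only B-variables, so t' has the coefficients
-- cᵢ on the variables outside B and d divides their gcd. Under A either
-- t' + k ≤ 0 or t' = -j for some 0 ≤ j < k. Under B, the modular equation for
-- t' + j makes d divide t' + j, so Σ cᵢxᵢ + c - (t' + j) is non-positive and
-- congruent to c modulo d, hence at most c - d⌈c/d⌉ = -k.
module Submission where

open import Defs
open import Data.Bool using (true; false; T)
open import Data.Bool.Properties using (T-≡)
open import Data.Empty using (⊥-elim)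
open import Data.Integer as ℤ
  using (ℤ; +_; -_; _+_; _*_; _-_; _≤_; _<_; ∣_∣; 0ℤ; _/ℕ_)
import Data.Integer.Properties as ℤP
import Data.Integer.Divisibility.Signed as S
open import Data.Integer.DivMod using (n<s[n/ℕd]*d)
open import Data.Integer.Tactic.RingSolver using (solve-∀)
open import Data.Nat as ℕ using (ℕ; zero; suc)
import Data.Nat.Properties as ℕP
import Data.Nat.Divisibility as ℕD
open import Data.Nat.GCD using (gcd; gcd[m,n]∣m; gcd[m,n]∣n; gcd-greatest)
open import Data.List using ([]; _∷_; map; [_]; _++_; upTo)
open import Data.List.Relation.Unary.All as All using (All; []; _∷_)
import Data.List.Relation.Unary.All.Properties as AllP
open import Data.List.Relation.Unary.Any as Any using (Any; here)
import Data.List.Relation.Unary.Any.Properties as AnyP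
open import Data.List.Membership.Propositional using (_∈_; find; lose)
open import Data.List.Membership.Propositional.Properties
  using (∈-map⁺; ∈-map⁻; ∈-concatMap⁺; ∈-concatMap⁻; ∈-++⁺ˡ; ∈-++⁺ʳ; ∈-++⁻; ∈-upTo⁺)
open import Data.Product using (_×_; _,_; proj₁; proj₂; ∃; ∃₂)
open import Data.Sum using (_⊎_; inj₁; inj₂; [_,_]′)
open import Function using (Equivalence)
open import Relation.Binary.PropositionalEquality
  using (_≡_; refl; sym; trans; cong; cong₂; subst; subst₂; module ≡-Reasoning)
open import Relation.Nullary using (¬_; yes; no)

private
  variable
    A B C : Conj
    t u : Term
    σ : Assignment
    x : Var

evalL-addL : ∀ cs ds σ → evalL (addL cs ds) σ ≡ evalL cs σ + evalL ds σ
evalL-addL []       ds       σ = sym (ℤP.+-identityˡ _)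
evalL-addL (c ∷ cs) []       σ = sym (ℤP.+-identityʳ _)
evalL-addL (c ∷ cs) (d ∷ ds) σ = begin
  (c + d) * σ 0 + evalL (addL cs ds) σ′          ≡⟨ cong (λ z → (c + d) * σ 0 + z) (evalL-addL cs ds σ′) ⟩
  (c + d) * σ 0 + (evalL cs σ′ + evalL ds σ′)     ≡⟨ distrib c d (σ 0) (evalL cs σ′) (evalL ds σ′) ⟩
  (c * σ 0 + evalL cs σ′) + (d * σ 0 + evalL ds σ′) ∎
  where
  open ≡-Reasoning
  σ′ : Assignment
  σ′ y = σ (suc y)
  distrib : ∀ a b y e f → (a + b) * y + (e + f) ≡ (a * y + e) + (b * y + f)
  distrib = solve-∀

evalL-map-* : ∀ a cs σ → evalL (map (a *_) cs) σ ≡ a * evalL cs σ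
evalL-map-* a []       σ = sym (ℤP.*-zeroʳ a)
evalL-map-* a (c ∷ cs) σ = begin
  a * c * σ 0 + evalL (map (a *_) cs) σ′ ≡⟨ cong (λ z → a * c * σ 0 + z) (evalL-map-* a cs σ′) ⟩
  a * c * σ 0 + a * evalL cs σ′          ≡⟨ distrib a c (σ 0) (evalL cs σ′) ⟩
  a * (c * σ 0 + evalL cs σ′)             ∎
  where
  open ≡-Reasoning
  σ′ : Assignment
  σ′ y = σ (suc y)
  distrib : ∀ a c y e → a * c * y + a * e ≡ a * (c * y + e)
  distrib = solve-∀

eval-⊕ : ∀ s t σ → ⟦ s ⊕ t ⟧ σ ≡ ⟦ s ⟧ σ + ⟦ t ⟧ σ
eval-⊕ s t σ = trans (cong (_+ (const s + const t)) (evalL-addL (coeffs s) (coeffs t) σ))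
                     (interchange (evalL (coeffs s) σ) (evalL (coeffs t) σ) (const s) (const t))
  where
  interchange : ∀ a b c d → (a + b) + (c + d) ≡ (a + c) + (b + d)
  interchange = solve-∀

eval-⊛ : ∀ a t σ → ⟦ a ⊛ t ⟧ σ ≡ a * ⟦ t ⟧ σ
eval-⊛ a t σ = trans (cong (_+ a * const t) (evalL-map-* a (coeffs t) σ))
                     (sym (ℤP.*-distribˡ-+ a _ _))

eval-⊝ : ∀ s t σ → ⟦ s ⊝ t ⟧ σ ≡ ⟦ s ⟧ σ - ⟦ t ⟧ σ
eval-⊝ s t σ = trans (eval-⊕ s (⊖ t) σ)
                     (cong (λ z → ⟦ s ⟧ σ + z) (trans (eval-⊛ ℤ.-1ℤ t σ) (ℤP.-1*i≡-i _)))

eval-+ᶜ : ∀ t k σ → ⟦ t +ᶜ k ⟧ σ ≡ ⟦ t ⟧ σ + k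
eval-+ᶜ t k σ = sym (ℤP.+-assoc (evalL (coeffs t) σ) (const t) k)

coeffL-addL : ∀ cs ds x → coeffL (addL cs ds) x ≡ coeffL cs x + coeffL ds x
coeffL-addL []       ds       x       = sym (ℤP.+-identityˡ _)
coeffL-addL (c ∷ cs) []       zero    = sym (ℤP.+-identityʳ _)
coeffL-addL (c ∷ cs) []       (suc x) = sym (ℤP.+-identityʳ _)
coeffL-addL (c ∷ cs) (d ∷ ds) zero    = refl
coeffL-addL (c ∷ cs) (d ∷ ds) (suc x) = coeffL-addL cs ds x

coeffL-map-* : ∀ a cs x → coeffL (map (a *_) cs) x ≡ a * coeffL cs x
coeffL-map-* a []       x       = sym (ℤP.*-zeroʳ a)
coeffL-map-* a (c ∷ cs) zero    = refl
coeffL-map-* a (c ∷ cs) (suc x) = coeffL-map-* a cs x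

coeff-⊝ : ∀ s t x → coeff (s ⊝ t) x ≡ coeff s x - coeff t x
coeff-⊝ s t x = trans (coeffL-addL (coeffs s) (coeffs (⊖ t)) x)
                      (cong (λ z → coeff s x + z) (trans (coeffL-map-* ℤ.-1ℤ (coeffs t) x) (ℤP.-1*i≡-i _)))

private
  *+*-diff : ∀ a b p q p′ q′ → (a * p + b * q) - (a * p′ + b * q′) ≡ a * (p - p′) + b * (q - q′)
  *+*-diff = solve-∀

eval-⊛⊕⊛ : ∀ a b u v σ → ⟦ (a ⊛ u) ⊕ (b ⊛ v) ⟧ σ ≡ a * ⟦ u ⟧ σ + b * ⟦ v ⟧ σ
eval-⊛⊕⊛ a b u v σ = trans (eval-⊕ (a ⊛ u) (b ⊛ v) σ) (cong₂ _+_ (eval-⊛ a u σ) (eval-⊛ b v σ))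

coeff-⊛⊕⊛ : ∀ a b u v x → coeff ((a ⊛ u) ⊕ (b ⊛ v)) x ≡ a * coeff u x + b * coeff v x
coeff-⊛⊕⊛ a b u v x =
  trans (coeffL-addL (coeffs (a ⊛ u)) (coeffs (b ⊛ v)) x)
        (cong₂ _+_ (coeffL-map-* a (coeffs u) x) (coeffL-map-* b (coeffs v) x))

eval-⊛⊕⊛-⊝ : ∀ a b s t u v σ →
  ⟦ ((a ⊛ s) ⊕ (b ⊛ t)) ⊝ ((a ⊛ u) ⊕ (b ⊛ v)) ⟧ σ ≡ a * ⟦ s ⊝ u ⟧ σ + b * ⟦ t ⊝ v ⟧ σ
eval-⊛⊕⊛-⊝ a b s t u v σ = begin
  ⟦ ((a ⊛ s) ⊕ (b ⊛ t)) ⊝ ((a ⊛ u) ⊕ (b ⊛ v)) ⟧ σ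
    ≡⟨ eval-⊝ ((a ⊛ s) ⊕ (b ⊛ t)) ((a ⊛ u) ⊕ (b ⊛ v)) σ ⟩
  ⟦ (a ⊛ s) ⊕ (b ⊛ t) ⟧ σ - ⟦ (a ⊛ u) ⊕ (b ⊛ v) ⟧ σ
    ≡⟨ cong₂ _-_ (eval-⊛⊕⊛ a b s t σ) (eval-⊛⊕⊛ a b u v σ) ⟩
  (a * ⟦ s ⟧ σ + b * ⟦ t ⟧ σ) - (a * ⟦ u ⟧ σ + b * ⟦ v ⟧ σ)
    ≡⟨ *+*-diff a b _ _ _ _ ⟩
  a * (⟦ s ⟧ σ - ⟦ u ⟧ σ) + b * (⟦ t ⟧ σ - ⟦ v ⟧ σ)
    ≡⟨ sym (cong₂ (λ p q → a * p + b * q) (eval-⊝ s u σ) (eval-⊝ t v σ)) ⟩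
  a * ⟦ s ⊝ u ⟧ σ + b * ⟦ t ⊝ v ⟧ σ ∎
  where open ≡-Reasoning

coeff-⊛⊕⊛-⊝ : ∀ a b s t u v x →
  coeff (((a ⊛ s) ⊕ (b ⊛ t)) ⊝ ((a ⊛ u) ⊕ (b ⊛ v))) x ≡ a * coeff (s ⊝ u) x + b * coeff (t ⊝ v) x
coeff-⊛⊕⊛-⊝ a b s t u v x = begin
  coeff (((a ⊛ s) ⊕ (b ⊛ t)) ⊝ ((a ⊛ u) ⊕ (b ⊛ v))) x
    ≡⟨ coeff-⊝ ((a ⊛ s) ⊕ (b ⊛ t)) ((a ⊛ u) ⊕ (b ⊛ v)) x ⟩
  coeff ((a ⊛ s) ⊕ (b ⊛ t)) x - coeff ((a ⊛ u) ⊕ (b ⊛ v)) x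
    ≡⟨ cong₂ _-_ (coeff-⊛⊕⊛ a b s t x) (coeff-⊛⊕⊛ a b u v x) ⟩
  (a * coeff s x + b * coeff t x) - (a * coeff u x + b * coeff v x)
    ≡⟨ *+*-diff a b _ _ _ _ ⟩
  a * (coeff s x - coeff u x) + b * (coeff t x - coeff v x)
    ≡⟨ sym (cong₂ (λ p q → a * p + b * q) (coeff-⊝ s u x) (coeff-⊝ t v x)) ⟩
  a * coeff (s ⊝ u) x + b * coeff (t ⊝ v) x ∎
  where open ≡-Reasoning

≼-resp-coeff : ∀ t u → (∀ x → coeff t x ≡ coeff u x) → u ≼ C → t ≼ C
≼-resp-coeff _ _ t≡u u≼C x t∋x = u≼C x (λ u₀ → t∋x (trans (t≡u x) u₀))

≼-vanishing : ∀ t → (∀ x → coeff t x ≡ 0ℤ) → t ≼ C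
≼-vanishing _ t≡0 x t∋x = ⊥-elim (t∋x (t≡0 x))

≼-lin : ∀ t a u b v → (∀ x → coeff t x ≡ a * coeff u x + b * coeff v x) → u ≼ C → v ≼ C → t ≼ C
≼-lin t a u b v t≡ u≼C v≼C x t∋x with coeff u x ℤ.≟ 0ℤ | coeff v x ℤ.≟ 0ℤ
... | no u∋x | _      = u≼C x u∋x
... | yes _  | no v∋x = v≼C x v∋x
... | yes u₀ | yes v₀ = ⊥-elim (t∋x (begin
  coeff t x                         ≡⟨ t≡ x ⟩
  a * coeff u x + b * coeff v x     ≡⟨ cong₂ (λ p q → a * p + b * q) u₀ v₀ ⟩
  a * 0ℤ + b * 0ℤ                   ≡⟨ cong₂ _+_ (ℤP.*-zeroʳ a) (ℤP.*-zeroʳ b) ⟩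
  0ℤ                                ∎))
  where open ≡-Reasoning

coeff-agree : ∀ s t → (s ⊝ t) ≼ C → ¬ OccursIn x C → coeff s x ≡ coeff t x
coeff-agree {x = x} s t s-t≼C x∉C with coeff (s ⊝ t) x ℤ.≟ 0ℤ
... | yes s-t₀ = ℤP.i-j≡0⇒i≡j _ _ (trans (sym (coeff-⊝ s t x)) s-t₀)
... | no  s-t∋x = ⊥-elim (x∉C (s-t≼C x s-t∋x))

constraint-≼ : le t ∈ C ⊎ eq t ∈ C → t ≼ C
constraint-≼ (inj₁ le∈C) x t∋x = Any.map (λ { refl → t∋x }) le∈C
constraint-≼ (inj₂ eq∈C) x t∋x = Any.map (λ { refl → t∋x }) eq∈C

constraint-≤0 : le t ∈ C ⊎ eq t ∈ C → holds C σ → ⟦ t ⟧ σ ≤ 0ℤ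
constraint-≤0 (inj₁ le∈C) ⊨C = All.lookup ⊨C le∈C
constraint-≤0 (inj₂ eq∈C) ⊨C = ℤP.≤-reflexive (All.lookup ⊨C eq∈C)

valid-singleton⁺ : (∀ σ → holds A σ → ⟦ u ⟧ σ ≤ 0ℤ) → (∀ σ → holds B σ → ⟦ t ⊝ u ⟧ σ ≤ 0ℤ) →
                   u ≼ A → (t ⊝ u) ≼ B → Valid A B t [ u , [] ]
valid-singleton⁺ A⊨u B⊨t-u u≼A t-u≼B = record
  { cond1 = λ σ ⊨A → here (A⊨u σ ⊨A , [])
  ; cond2 = λ { _ (here refl) σ ⊨B _ → B⊨t-u σ ⊨B }
  ; cond3 = λ { _ (here refl) → u≼A , t-u≼B , (λ _ ()) , (λ _ ()) }
  }

valid-singleton⁻ : Valid A B t [ u , [] ] →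
                   (∀ σ → holds A σ → ⟦ u ⟧ σ ≤ 0ℤ) × (∀ σ → holds B σ → ⟦ t ⊝ u ⟧ σ ≤ 0ℤ) ×
                   u ≼ A × (t ⊝ u) ≼ B
valid-singleton⁻ valid =
  (λ σ ⊨A → proj₁ (AnyP.singleton⁻ (Valid.cond1 valid σ ⊨A))) ,
  (λ σ ⊨B → Valid.cond2 valid _ (here refl) σ ⊨B []) ,
  proj₁ (Valid.cond3 valid _ (here refl)) ,
  proj₁ (proj₂ (Valid.cond3 valid _ (here refl)))

hypA-sound : HypA-sound
hypA-sound A B t t∈A = valid-singleton⁺
  (λ _ → constraint-≤0 t∈A)
  (λ σ _ → ℤP.≤-reflexive (trans (eval-⊝ t t σ) (ℤP.+-inverseʳ (⟦ t ⟧ σ))))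
  (constraint-≼ t∈A)
  (≼-vanishing (t ⊝ t) (λ x → trans (coeff-⊝ t t x) (ℤP.+-inverseʳ (coeff t x))))

hypB-sound : HypB-sound
hypB-sound A B t t∈B = valid-singleton⁺
  (λ _ _ → ℤP.≤-refl)
  (λ σ ⊨B → subst (_≤ 0ℤ) (sym (trans (eval-⊝ t 𝟘 σ) (ℤP.+-identityʳ _))) (constraint-≤0 t∈B ⊨B))
  (≼-vanishing 𝟘 (λ _ → refl))
  (≼-resp-coeff (t ⊝ 𝟘) t (λ x → trans (coeff-⊝ t 𝟘 x) (ℤP.+-identityʳ _)) (constraint-≼ t∈B))

module _ (c₁ c₂ : ℤ) where

  combine : AnnElem → AnnElem → AnnElem
  combine p₁ p₂ = (c₁ ⊛ proj₁ p₁) ⊕ (c₂ ⊛ proj₁ p₂) , proj₂ p₁ ++ proj₂ p₂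

  ∈-combAnn⁺ : ∀ {I₁ I₂ p₁ p₂} → p₁ ∈ I₁ → p₂ ∈ I₂ → combine p₁ p₂ ∈ combAnn c₁ c₂ I₁ I₂
  ∈-combAnn⁺ p₁∈I₁ p₂∈I₂ = ∈-concatMap⁺ _ (Any.map (λ { refl → ∈-map⁺ _ p₂∈I₂ }) p₁∈I₁)

  ∈-combAnn⁻ : ∀ I₁ I₂ {p} → p ∈ combAnn c₁ c₂ I₁ I₂ →
               ∃₂ λ p₁ p₂ → p₁ ∈ I₁ × p₂ ∈ I₂ × p ≡ combine p₁ p₂
  ∈-combAnn⁻ I₁ I₂ p∈I
    with p₁ , p₁∈I₁ , p∈row ← find (∈-concatMap⁻ _ {xs = I₁} p∈I)
    with p₂ , p₂∈I₂ , refl ← ∈-map⁻ _ p∈row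
    = p₁ , p₂ , p₁∈I₁ , p₂∈I₂ , refl

*-pos-≤0 : ∀ c {a} → 0ℤ < c → a ≤ 0ℤ → c * a ≤ 0ℤ
*-pos-≤0 c {a} 0<c a≤0 =
  subst (c * a ≤_) (ℤP.*-zeroʳ c) (ℤP.*-monoˡ-≤-nonNeg c {{ℤ.nonNegative (ℤP.<⇒≤ 0<c)}} a≤0)

comb-sound : Comb-sound
comb-sound A B t₁ t₂ I₁ I₂ c₁ c₂ 0<c₁ 0<c₂ v₁ v₂ =
  record { cond1 = covers ; cond2 = bounded ; cond3 = separated }
  where
  open Valid

  pos-comb-≤0 : ∀ {a b} → a ≤ 0ℤ → b ≤ 0ℤ → c₁ * a + c₂ * b ≤ 0ℤ
  pos-comb-≤0 a≤0 b≤0 = ℤP.+-mono-≤ (*-pos-≤0 c₁ 0<c₁ a≤0) (*-pos-≤0 c₂ 0<c₂ b≤0)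

  covers : ∀ σ → holds A σ →
           Any (λ p → (⟦ proj₁ p ⟧ σ ≤ 0ℤ) × holdsEs (proj₂ p) σ) (combAnn c₁ c₂ I₁ I₂)
  covers σ ⊨A
    with (u₁ , E₁) , p₁∈I₁ , u₁≤0 , ⊨E₁ ← find (cond1 v₁ σ ⊨A)
       | (u₂ , E₂) , p₂∈I₂ , u₂≤0 , ⊨E₂ ← find (cond1 v₂ σ ⊨A)
    = lose (∈-combAnn⁺ c₁ c₂ p₁∈I₁ p₂∈I₂)
           ( subst (_≤ 0ℤ) (sym (eval-⊛⊕⊛ c₁ c₂ u₁ u₂ σ)) (pos-comb-≤0 u₁≤0 u₂≤0)
           , AllP.++⁺ ⊨E₁ ⊨E₂ )

  bounded : ∀ p → p ∈ combAnn c₁ c₂ I₁ I₂ → ∀ σ → holds B σ → holdsEs (proj₂ p) σ →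
            ⟦ ((c₁ ⊛ t₁) ⊕ (c₂ ⊛ t₂)) ⊝ proj₁ p ⟧ σ ≤ 0ℤ
  bounded _ p∈I σ ⊨B ⊨E
    with (u₁ , E₁) , (u₂ , E₂) , p₁∈I₁ , p₂∈I₂ , refl ← ∈-combAnn⁻ c₁ c₂ I₁ I₂ p∈I
    with ⊨E₁ , ⊨E₂ ← AllP.++⁻ E₁ ⊨E
    = subst (_≤ 0ℤ) (sym (eval-⊛⊕⊛-⊝ c₁ c₂ t₁ t₂ u₁ u₂ σ))
        (pos-comb-≤0 (cond2 v₁ _ p₁∈I₁ σ ⊨B ⊨E₁) (cond2 v₂ _ p₂∈I₂ σ ⊨B ⊨E₂))

  separated : ∀ p → p ∈ combAnn c₁ c₂ I₁ I₂ →
              (proj₁ p ≼ A) × ((((c₁ ⊛ t₁) ⊕ (c₂ ⊛ t₂)) ⊝ proj₁ p) ≼ B) ×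
              (proj₂ p ≼ᴱ A) × (proj₂ p ≼ᴱ B)
  separated _ p∈I
    with (u₁ , E₁) , (u₂ , E₂) , p₁∈I₁ , p₂∈I₂ , refl ← ∈-combAnn⁻ c₁ c₂ I₁ I₂ p∈I
    with u₁≼A , t₁-u₁≼B , E₁≼A , E₁≼B ← cond3 v₁ _ p₁∈I₁
       | u₂≼A , t₂-u₂≼B , E₂≼A , E₂≼B ← cond3 v₂ _ p₂∈I₂
    = ≼-lin ((c₁ ⊛ u₁) ⊕ (c₂ ⊛ u₂)) c₁ u₁ c₂ u₂ (coeff-⊛⊕⊛ c₁ c₂ u₁ u₂) u₁≼A u₂≼A
    , ≼-lin (((c₁ ⊛ t₁) ⊕ (c₂ ⊛ t₂)) ⊝ ((c₁ ⊛ u₁) ⊕ (c₂ ⊛ u₂))) c₁ (t₁ ⊝ u₁) c₂ (t₂ ⊝ u₂) (coeff-⊛⊕⊛-⊝ c₁ c₂ t₁ t₂ u₁ u₂) t₁-u₁≼B t₂-u₂≼B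
    , (λ x x∈E → [ E₁≼A x , E₂≼A x ]′ (AnyP.++⁻ E₁ x∈E))
    , (λ x x∈E → [ E₁≼B x , E₂≼B x ]′ (AnyP.++⁻ E₁ x∈E))

T-occurs? : ∀ t → T (occurs? x t) → Occurs x t
T-occurs? {x} t x∈t with coeff t x ℤ.≟ 0ℤ
... | no t∋x = t∋x

occurs?-T : ∀ t → Occurs x t → T (occurs? x t)
occurs?-T {x} t t∋x with coeff t x ℤ.≟ 0ℤ
... | yes t₀ = t∋x t₀
... | no  _  = _

occursIn?-true : occursIn? x C ≡ true → OccursIn x C
occursIn?-true {C = C} x∈C? =
  Any.map (λ {c} → T-occurs? (termOf c)) (AnyP.any⁻ _ C (Equivalence.from T-≡ x∈C?))

occursIn?-false : occursIn? x C ≡ false → ¬ OccursIn x C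
occursIn?-false x∈C? x∈C = subst T x∈C? (AnyP.any⁺ _ (Any.map (λ {c} → occurs?-T (termOf c)) x∈C))

-- restrictB and gcdNotB start at variable i, so the list position x is the variable i + x.

restrictB-coeff : ∀ B i cs x → ¬ coeffL (restrictB B i cs) x ≡ 0ℤ →
                  ¬ coeffL cs x ≡ 0ℤ × OccursIn (i ℕ.+ x) B
restrictB-coeff B i []       x       nz = ⊥-elim (nz refl)
restrictB-coeff B i (c ∷ cs) zero    nz with occursIn? i B in i∈B?
... | true  = nz , subst (λ y → OccursIn y B) (sym (ℕP.+-identityʳ i)) (occursIn?-true i∈B?)
... | false = ⊥-elim (nz refl)
restrictB-coeff B i (c ∷ cs) (suc x) nz
  with cs∋x , x∈B ← restrictB-coeff B (suc i) cs x nz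
  = cs∋x , subst (λ y → OccursIn y B) (sym (ℕP.+-suc i x)) x∈B

tail-∉ : ∀ {P : ℕ → Set} B i → (∀ x → ¬ OccursIn (i ℕ.+ x) B → P x) →
        ∀ x → ¬ OccursIn (suc i ℕ.+ x) B → P (suc x)
tail-∉ B i h x x∉B = h (suc x) (subst (λ y → ¬ OccursIn y B) (sym (ℕP.+-suc i x)) x∉B)

gcdNotB-greatest : ∀ {d} B i cs → (∀ x → ¬ OccursIn (i ℕ.+ x) B → d ℕD.∣ ∣ coeffL cs x ∣) →
                   d ℕD.∣ gcdNotB B i cs
gcdNotB-greatest B i []       _    = _ ℕD.∣0
gcdNotB-greatest B i (c ∷ cs) d∣cs with occursIn? i B in i∈B?
... | true  = gcdNotB-greatest B (suc i) cs (tail-∉ B i d∣cs)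
... | false = gcd-greatest
  (d∣cs 0 (subst (λ y → ¬ OccursIn y B) (sym (ℕP.+-identityʳ i)) (occursIn?-false i∈B?)))
  (gcdNotB-greatest B (suc i) cs (tail-∉ B i d∣cs))

gcdNotB∣dropped : ∀ B i cs σ → + gcdNotB B i cs S.∣ evalL cs σ - evalL (restrictB B i cs) σ
gcdNotB∣dropped B i []       σ = S.∣ᵤ⇒∣ (_ ℕD.∣0)
gcdNotB∣dropped B i (c ∷ cs) σ with occursIn? i B
... | true  = subst (S._∣_ _) (sym (kept c (σ 0) _ _)) (gcdNotB∣dropped B (suc i) cs σ′)
  where
  σ′ : Assignment
  σ′ y = σ (suc y)
  kept : ∀ c y e r → (c * y + e) - (c * y + r) ≡ e - r
  kept = solve-∀
... | false = subst (S._∣_ _) (sym (dropped c (σ 0) _ _))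
  (S.∣m∣n⇒∣m+n (S.∣m⇒∣m*n (σ 0) (S.∣ᵤ⇒∣ {i = c} (gcd[m,n]∣m ∣ c ∣ g)))
               (S.∣-trans (S.∣ᵤ⇒∣ {i = + g} (gcd[m,n]∣n ∣ c ∣ g)) (gcdNotB∣dropped B (suc i) cs σ′)))
  where
  σ′ : Assignment
  σ′ y = σ (suc y)
  g : ℕ
  g = gcdNotB B (suc i) cs
  dropped : ∀ c y e r → (c * y + e) - (0ℤ * y + r) ≡ c * y + (e - r)
  dropped = solve-∀

⟦⟧≡⟦restrictB⟧+dropped : ∀ B t σ →
  ⟦ t ⟧ σ ≡ ⟦ term (restrictB B 0 (coeffs t)) (const t) ⟧ σ
            + (evalL (coeffs t) σ - evalL (restrictB B 0 (coeffs t)) σ)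
⟦⟧≡⟦restrictB⟧+dropped B t σ = split (evalL (coeffs t) σ) (evalL (restrictB B 0 (coeffs t)) σ) (const t)
  where
  split : ∀ e r c → e + c ≡ (r + c) + (e - r)
  split = solve-∀

elimNotB-intro : ∀ B t → ⟦ t ⟧ σ ≡ 0ℤ → holdsEs (elimNotB B t) σ
elimNotB-intro {σ} B t t≡0 = S.∣⇒∣ᵤ g∣restricted ∷ []
  where
  g∣restricted : + gcdNotB B 0 (coeffs t) S.∣ ⟦ term (restrictB B 0 (coeffs t)) (const t) ⟧ σ
  g∣restricted = S.∣m+n∣n⇒∣m
    (subst (S._∣_ _) (trans (sym t≡0) (⟦⟧≡⟦restrictB⟧+dropped B t σ)) (S.∣ᵤ⇒∣ (_ ℕD.∣0)))
    (gcdNotB∣dropped B 0 (coeffs t) σ)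

elimNotB-elim : ∀ B t → holdsEs (elimNotB B t) σ → + gcdNotB B 0 (coeffs t) S.∣ ⟦ t ⟧ σ
elimNotB-elim {σ} B t (g∣restricted ∷ []) =
  subst (S._∣_ _) (sym (⟦⟧≡⟦restrictB⟧+dropped B t σ))
    (S.∣m∣n⇒∣m+n (S.∣ᵤ⇒∣ {i = ⟦ term (restrictB B 0 (coeffs t)) (const t) ⟧ σ} g∣restricted)
                 (gcdNotB∣dropped B 0 (coeffs t) σ))

elimNotB-≼ : ∀ B t → t ≼ C → elimNotB B t ≼ᴱ C × elimNotB B t ≼ᴱ B
elimNotB-≼ B t t≼C =
  (λ { x (here x∈E) → t≼C x (proj₁ (restrictB-coeff B 0 (coeffs t) x x∈E)) })
  , (λ { x (here x∈E) → proj₂ (restrictB-coeff B 0 (coeffs t) x x∈E) })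

All-coeffL : ∀ {P : ℤ → Set} {cs} → P 0ℤ → All P cs → ∀ x → P (coeffL cs x)
All-coeffL P0 []          x       = P0
All-coeffL P0 (Pc ∷ Pcs)  zero    = Pc
All-coeffL P0 (Pc ∷ Pcs)  (suc x) = All-coeffL P0 Pcs x

∣-evalL : ∀ {k cs} → All (k S.∣_) cs → ∀ σ → k S.∣ evalL cs σ
∣-evalL []            σ = S.∣ᵤ⇒∣ (_ ℕD.∣0)
∣-evalL (k∣c ∷ k∣cs) σ = S.∣m∣n⇒∣m+n (S.∣m⇒∣m*n (σ 0) k∣c) (∣-evalL k∣cs (λ y → σ (suc y)))

m*d≤n⇒m≤n/ℕd : ∀ m n d .{{_ : ℕ.NonZero d}} → m * + d ≤ n → m ≤ n /ℕ d
m*d≤n⇒m≤n/ℕd m n d m*d≤n = ℤP.≮⇒≥ λ n/d<m →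
  ℤP.≤⇒≯ (ℤP.≤-trans (ℤP.*-monoʳ-≤-nonNeg (+ d) (ℤP.i<j⇒suc[i]≤j n/d<m)) m*d≤n) (n<s[n/ℕd]*d n d)

rounding : ∀ n c x → + suc n S.∣ x - c → x ≤ 0ℤ → x + (+ suc n * ceilDiv c (suc n) - c) ≤ 0ℤ
rounding n c x (S.divides q x-c≡qd) x≤0 = subst (_≤ 0ℤ) (sym value) (begin
  (q - f) * D ≤⟨ ℤP.*-monoʳ-≤-nonNeg D (ℤP.i≤j⇒i-j≤0 q≤f) ⟩
  0ℤ * D      ≡⟨ ℤP.*-zeroˡ D ⟩
  0ℤ          ∎)
  where
  open ℤP.≤-Reasoning
  D f : ℤ
  D = + suc n
  f = (- c) /ℕ suc n
  q≤f : q ≤ f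
  q≤f = m*d≤n⇒m≤n/ℕd q (- c) (suc n)
          (subst (_≤ - c) x-c≡qd (subst (x - c ≤_) (ℤP.+-identityˡ (- c)) (ℤP.+-monoˡ-≤ (- c) x≤0)))
  shuffle : ∀ x c f → x + (D * - f - c) ≡ (x - c) - f * D
  shuffle = solve-∀
  distrib : ∀ q f → q * D - f * D ≡ (q - f) * D
  distrib = solve-∀
  value : x + (D * ceilDiv c (suc n) - c) ≡ (q - f) * D
  value = trans (shuffle x c f) (trans (cong (_- f * D) x-c≡qd) (distrib q f))

∣gcdNotB : ∀ {d} B s t → (s ⊝ t) ≼ B → (∀ x → d ℕD.∣ ∣ coeff s x ∣) → d ℕD.∣ gcdNotB B 0 (coeffs t)
∣gcdNotB {d} B s t s-t≼B d∣s = gcdNotB-greatest B 0 (coeffs t)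
  (λ x x∉B → subst (λ z → d ℕD.∣ ∣ z ∣) (coeff-agree s t s-t≼B x∉B) (d∣s x))

eval-+ᶜ-⊝-+ᶜ : ∀ s a u b σ → ⟦ (s +ᶜ a) ⊝ (u +ᶜ b) ⟧ σ ≡ ⟦ s ⊝ u ⟧ σ + (a - b)
eval-+ᶜ-⊝-+ᶜ s a u b σ = begin
  ⟦ (s +ᶜ a) ⊝ (u +ᶜ b) ⟧ σ        ≡⟨ eval-⊝ (s +ᶜ a) (u +ᶜ b) σ ⟩
  ⟦ s +ᶜ a ⟧ σ - ⟦ u +ᶜ b ⟧ σ      ≡⟨ cong₂ _-_ (eval-+ᶜ s a σ) (eval-+ᶜ u b σ) ⟩
  (⟦ s ⟧ σ + a) - (⟦ u ⟧ σ + b)    ≡⟨ regroup (⟦ s ⟧ σ) (⟦ u ⟧ σ) a b ⟩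
  (⟦ s ⟧ σ - ⟦ u ⟧ σ) + (a - b)    ≡⟨ cong (_+ (a - b)) (sym (eval-⊝ s u σ)) ⟩
  ⟦ s ⊝ u ⟧ σ + (a - b)            ∎
  where
  open ≡-Reasoning
  regroup : ∀ p q a b → (p + a) - (q + b) ≡ (p - q) + (a - b)
  regroup = solve-∀

+<⇒<∣∣ : ∀ {m k} → + m < k → m ℕ.< ∣ k ∣
+<⇒<∣∣ (ℤ.+<+ m<n) = m<n

strengthenAnn-covers : ∀ B t′ k σ → ⟦ t′ ⟧ σ ≤ 0ℤ →
  Any (λ p → (⟦ proj₁ p ⟧ σ ≤ 0ℤ) × holdsEs (proj₂ p) σ) (strengthenAnn B t′ k)
strengthenAnn-covers B t′ k σ t′≤0 with ⟦ t′ ⟧ σ + k ℤP.≤? 0ℤ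
... | yes t′+k≤0 = lose (∈-++⁺ʳ (map _ (upTo ∣ k ∣)) (here refl))
                        (subst (_≤ 0ℤ) (sym (eval-+ᶜ t′ k σ)) t′+k≤0 , [])
... | no  t′+k≰0 = lose (∈-++⁺ˡ (∈-map⁺ _ (∈-upTo⁺ (+<⇒<∣∣ j<k))))
                        (ℤP.≤-reflexive t′+j≡0 , elimNotB-intro B (t′ +ᶜ (+ j)) t′+j≡0)
  where
  b : ℤ
  b = ⟦ t′ ⟧ σ
  j : ℕ
  j = ∣ - b ∣
  j≡-b : + j ≡ - b
  j≡-b = ℤP.0≤i⇒+∣i∣≡i (ℤP.neg-mono-≤ t′≤0)
  t′+j≡0 : ⟦ t′ +ᶜ (+ j) ⟧ σ ≡ 0ℤ
  t′+j≡0 = trans (eval-+ᶜ t′ (+ j) σ) (trans (cong (λ z → b + z) j≡-b) (ℤP.+-inverseʳ b))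
  cancel : ∀ b k → - b + (b + k) ≡ k
  cancel = solve-∀
  j<k : + j < k
  j<k = subst₂ _<_ (trans (ℤP.+-identityʳ (- b)) (sym j≡-b)) (cancel b k)
                   (ℤP.+-monoʳ-< (- b) (ℤP.≰⇒> t′+k≰0))

∈-strengthenAnn⁻ : ∀ B t′ k {p} → p ∈ strengthenAnn B t′ k →
  (∃ λ j → p ≡ (t′ +ᶜ (+ j) , elimNotB B (t′ +ᶜ (+ j)))) ⊎ p ≡ (t′ +ᶜ k , [])
∈-strengthenAnn⁻ B t′ k p∈ with ∈-++⁻ (map _ (upTo ∣ k ∣)) p∈
... | inj₁ p∈map with j , _ , p≡ ← ∈-map⁻ _ p∈map = inj₁ (j , p≡)
... | inj₂ (here p≡) = inj₂ p≡

strengthen-bound : ∀ B cs c t′ n j σ → All (+ suc n S.∣_) cs → suc n ℕD.∣ gcdNotB B 0 (coeffs t′) →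
  ⟦ term cs c ⊝ t′ ⟧ σ ≤ 0ℤ → holdsEs (elimNotB B (t′ +ᶜ (+ j))) σ →
  ⟦ (term cs c +ᶜ (+ suc n * ceilDiv c (suc n) - c)) ⊝ (t′ +ᶜ (+ j)) ⟧ σ ≤ 0ℤ
strengthen-bound B cs c t′ n j σ d∣cs d∣g s-t′≤0 ⊨E =
  subst (_≤ 0ℤ) (sym value) (rounding n c r d∣r-c (ℤP.i≤j⇒i-k≤j (+ j) s-t′≤0))
  where
  s : Term
  s = term cs c
  k : ℤ
  k = + suc n * ceilDiv c (suc n) - c
  r : ℤ
  r = ⟦ s ⊝ t′ ⟧ σ - + j
  value : ⟦ (s +ᶜ k) ⊝ (t′ +ᶜ (+ j)) ⟧ σ ≡ r + k
  value = trans (eval-+ᶜ-⊝-+ᶜ s k t′ (+ j) σ) (swap (⟦ s ⊝ t′ ⟧ σ) k (+ j))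
    where
    swap : ∀ y k j → y + (k - j) ≡ (y - j) + k
    swap = solve-∀
  r-c≡ : r - c ≡ evalL cs σ - ⟦ t′ +ᶜ (+ j) ⟧ σ
  r-c≡ = trans (cong (λ y → (y - + j) - c) (eval-⊝ s t′ σ))
               (trans (regroup (evalL cs σ) c (⟦ t′ ⟧ σ) (+ j)) (cong (λ z → evalL cs σ - z) (sym (eval-+ᶜ t′ (+ j) σ))))
    where
    regroup : ∀ e c b j → (((e + c) - b) - j) - c ≡ e - (b + j)
    regroup = solve-∀
  d∣r-c : + suc n S.∣ r - c
  d∣r-c = subst (S._∣_ _) (sym r-c≡)
    (S.∣m∣n⇒∣m-n (∣-evalL d∣cs σ)
      (S.∣-trans (S.∣ᵤ⇒∣ {i = + gcdNotB B 0 (coeffs t′)} d∣g) (elimNotB-elim B (t′ +ᶜ (+ j)) ⊨E)))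

strengthen-sound : Strengthen-sound
strengthen-sound A B cs c t′ zero    () _ _
strengthen-sound A B cs c t′ (suc n) _ d∣cs premise
  with A⊨t′ , B⊨s-t′ , t′≼A , s-t′≼B ← valid-singleton⁻ premise =
  record { cond1 = covers ; cond2 = bounded ; cond3 = separated }
  where
  s : Term
  s = term cs c
  k : ℤ
  k = + suc n * ceilDiv c (suc n) - c

  d∣g : suc n ℕD.∣ gcdNotB B 0 (coeffs t′)
  d∣g = ∣gcdNotB B s t′ s-t′≼B (All-coeffL (suc n ℕD.∣0) d∣cs)

  covers : ∀ σ → holds A σ → Any (λ p → (⟦ proj₁ p ⟧ σ ≤ 0ℤ) × holdsEs (proj₂ p) σ) (strengthenAnn B t′ k)
  covers σ ⊨A = strengthenAnn-covers B t′ k σ (A⊨t′ σ ⊨A)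

  bounded : ∀ p → p ∈ strengthenAnn B t′ k → ∀ σ → holds B σ → holdsEs (proj₂ p) σ →
            ⟦ (s +ᶜ k) ⊝ proj₁ p ⟧ σ ≤ 0ℤ
  bounded _ p∈ σ ⊨B ⊨E with ∈-strengthenAnn⁻ B t′ k p∈
  ... | inj₁ (j , refl) =
    strengthen-bound B cs c t′ n j σ (All.map (λ {cᵢ} → S.∣ᵤ⇒∣ {i = cᵢ}) d∣cs) d∣g (B⊨s-t′ σ ⊨B) ⊨E
  ... | inj₂ refl = subst (_≤ 0ℤ) (sym unchanged) (B⊨s-t′ σ ⊨B)
    where
    unchanged : ⟦ (s +ᶜ k) ⊝ (t′ +ᶜ k) ⟧ σ ≡ ⟦ s ⊝ t′ ⟧ σ
    unchanged = trans (eval-+ᶜ-⊝-+ᶜ s k t′ k σ)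
                      (trans (cong (λ z → ⟦ s ⊝ t′ ⟧ σ + z) (ℤP.+-inverseʳ k)) (ℤP.+-identityʳ _))

  separated : ∀ p → p ∈ strengthenAnn B t′ k →
              (proj₁ p ≼ A) × (((s +ᶜ k) ⊝ proj₁ p) ≼ B) × (proj₂ p ≼ᴱ A) × (proj₂ p ≼ᴱ B)
  separated _ p∈ with ∈-strengthenAnn⁻ B t′ k p∈
  ... | inj₁ (j , refl) = t′≼A , s-t′≼B , elimNotB-≼ B (t′ +ᶜ (+ j)) t′≼A
  ... | inj₂ refl       = t′≼A , s-t′≼B , (λ _ ()) , (λ _ ())

theorem3p5 : HypA-sound × HypB-sound × Comb-sound × Strengthen-sound
theorem3p5 = hypA-sound , hypB-sound , comb-sound , strengthen-sound
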